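{- Let $\{x_{n,m}\}_{n\in\mathbb{N}^*,\,1\le m\le n}\subset\mathbb{C}$ satisfy $x_{n+1,k+1}=\sum_{j=k}^{n}x_{n,j}$ for all $n\in\mathbb{N}^*$ and $k\in\{1,\ldots,n\}$. Then for every $n\ge 3$, $$x_{n,3}=\sum_{h=0}^{n-3}C_2(h,h+1)\,x_{n-h-2,1}.$$
   Context: For $m\in\mathbb{N}^*$, $n\in\mathbb{N}$ and $0\le k\le n+m-1$, $C_m(n,k)=\binom{n+k}{k}$ if $0\le k\le m-1$ and $C_m(n,k)=\binom{n+k}{k}-\binom{n+k}{k-m}$ if $m\le k\le n+m-1$ (Catalan's trapezoid of order $m$). -}

module Defs where

open import Level using (Level)
open import Data.Nat using (ℕ; zero; suc; _+_; _∸_; _<_; _<?_)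
open import Data.Nat.Combinatorics using (_C_)
open import Data.List using (List; applyUpTo; foldr)
open import Relation.Nullary using (yes; no)
open import Algebra.Bundles using (CommutativeRing)
import Algebra.Definitions.RawMonoid as RawMonoidDefs

-- Catalan's trapezoid of order m (m ≥ 1 intended; value irrelevant outside
-- the range 0 ≤ k ≤ n+m-1):
--   C_m(n,k) = binom(n+k,k)                     if k ≤ m-1
--   C_m(n,k) = binom(n+k,k) - binom(n+k,k-m)    if m ≤ k ≤ n+m-1
-- (the difference is nonnegative in that range, so truncated subtraction on ℕ
-- is exact.)
Ctrap : ℕ → ℕ → ℕ → ℕ
Ctrap m n k with k <? m
... | yes _ = (n + k) C k
... | no  _ = (n + k) C k ∸ (n + k) C (k ∸ m)

module _ {c ℓ : Level} (R : CommutativeRing c ℓ) where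
  open CommutativeRing R using (Carrier; 0#; +-rawMonoid) renaming (_+_ to _+R_)

  open RawMonoidDefs +-rawMonoid using (_×_) public

  -- Σ_{j=k}^{n} f j   (empty if n < k)
  sumFromTo : (ℕ → Carrier) → ℕ → ℕ → Carrier
  sumFromTo f k n = foldr _+R_ 0# (applyUpTo (λ i → f (k + i)) (suc n ∸ k))

{-# OPTIONS --safe #-}
-- Comparing the recurrence at k and at k + 1 gives x(n+1,k+1) = x(n,k) + x(n+1,k+2) for k < n,
-- and at k = n it gives x(n+1,n+1) = x(n,n).  Unfolding these two relations expresses
-- x(j+1+d, j+1) as Σ_{h ≤ d} b_j(h) x(d+1-h, 1), where b_j(0) = 1, b_0(h+1) = 0 and
-- b_{j+1}(h+1) = b_j(h+1) + b_{j+2}(h).  This is the recurrence of the ballot numbers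
-- b_j(g+1) = binom(2g+j+1, g+1) - binom(2g+j+1, g), so b_j(h) = C_j(h, h+j-1) for j ≥ 1.
module Submission where

open import Defs using (Ctrap; sumFromTo)
open import Level using (Level)
open import Algebra.Bundles using (CommutativeRing)
open import Data.Nat using (ℕ; zero; suc; _≤_; _<_; _∸_; _<?_; s≤s; z≤n) renaming (_+_ to _+ℕ_)
import Relation.Binary.PropositionalEquality as ≡

module Ballot where
  open import Data.Nat using (_+_)
  open import Data.Nat.Combinatorics using (_C_; nCn≡1; nC1≡n; nCk≡nC[n∸k]; nCk+nC[k+1]≡[n+1]C[k+1])
  open import Data.Nat.Properties
    using (+-comm; ∸-+-assoc; m+n∸n≡m; m+n∸m≡n; [m+n]∸[m+o]≡n∸o; m≤m+n; m≤n+m; n<1+n; ≤⇒≯)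
  open import Data.Nat.Tactic.RingSolver using (solve-∀)
  open import Relation.Nullary using (yes; no)
  open import Relation.Nullary.Negation using (contradiction)
  open ≡ using (_≡_; refl; sym; trans; cong; cong₂; subst)
  open ≡.≡-Reasoning

  [m+n]∸o∸m≡n∸o : ∀ m n o → m + n ∸ o ∸ m ≡ n ∸ o
  [m+n]∸o∸m≡n∸o m n o = begin
    m + n ∸ o ∸ m   ≡⟨ ∸-+-assoc (m + n) o m ⟩
    m + n ∸ (o + m) ≡⟨ cong (m + n ∸_) (+-comm o m) ⟩
    m + n ∸ (m + o) ≡⟨ [m+n]∸[m+o]≡n∸o m n o ⟩
    n ∸ o           ∎

  [m+n]Cm≡[m+n]Cn : ∀ m n → (m + n) C m ≡ (m + n) C n
  [m+n]Cm≡[m+n]Cn m n = trans (nCk≡nC[n∸k] (m≤m+n m n)) (cong ((m + n) C_) (m+n∸m≡n m n))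

  ballot : ℕ → ℕ → ℕ
  ballot _       zero    = 1
  ballot zero    (suc h) = 0
  ballot (suc j) (suc h) = ballot j (suc h) + ballot (suc (suc j)) h

  width : ℕ → ℕ → ℕ
  width j g = j + suc (g + g)

  ballot-one : ∀ j → ballot j 1 ≡ j
  ballot-one zero    = refl
  ballot-one (suc j) = trans (cong (_+ 1) (ballot-one j)) (+-comm j 1)

  ballot-binomial : ∀ j g → ballot j (suc g) + width j g C g ≡ width j g C suc g
  ballot-binomial j       zero    = trans (cong (_+ 1) (ballot-one j)) (sym (nC1≡n (j + 1)))
  ballot-binomial zero    (suc g) = sym ([m+n]Cm≡[m+n]Cn (suc (suc g)) (suc g))
  ballot-binomial (suc j) (suc g) = begin
    (a + b) + suc n C suc g          ≡⟨ cong ((a + b) +_) (sym (nCk+nC[k+1]≡[n+1]C[k+1] n g)) ⟩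
    (a + b) + (n C g + n C suc g)    ≡⟨ regroup a b (n C g) (n C suc g) ⟩
    (a + n C suc g) + (b + n C g)    ≡⟨ cong₂ _+_ (ballot-binomial j (suc g)) shifted ⟩
    n C suc (suc g) + n C suc g      ≡⟨ +-comm (n C suc (suc g)) (n C suc g) ⟩
    n C suc g + n C suc (suc g)      ≡⟨ nCk+nC[k+1]≡[n+1]C[k+1] n (suc g) ⟩
    suc n C suc (suc g)              ∎
    where
    a = ballot j (suc (suc g))
    b = ballot (suc (suc j)) (suc g)
    n = width j (suc g)
    regroup : ∀ a b c d → (a + b) + (c + d) ≡ (a + d) + (b + c)
    regroup = solve-∀
    width-shift : ∀ j g → suc (suc j) + suc (g + g) ≡ j + suc (suc g + suc g)
    width-shift = solve-∀
    shifted : b + n C g ≡ n C suc g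
    shifted = subst (λ m → b + m C g ≡ m C suc g) (width-shift j g) (ballot-binomial (suc (suc j)) g)

  Ctrap-below : ∀ {m n k} → k < m → Ctrap m n k ≡ (n + k) C k
  Ctrap-below {m} {n} {k} k<m with k <? m
  ... | yes _   = refl
  ... | no  k≮m = contradiction k<m k≮m

  Ctrap-above : ∀ {m n k} → m ≤ k → Ctrap m n k ≡ (n + k) C k ∸ (n + k) C (k ∸ m)
  Ctrap-above {m} {n} {k} m≤k with k <? m
  ... | yes k<m = contradiction k<m (≤⇒≯ m≤k)
  ... | no  _   = refl

  Ctrap-ballot : ∀ i h → Ctrap (suc i) h (h + i) ≡ ballot (suc i) h
  Ctrap-ballot i zero    = trans (Ctrap-below (n<1+n i)) (nCn≡1 i)
  Ctrap-ballot i (suc g) = begin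
    Ctrap (suc i) (suc g) (suc g + i)
      ≡⟨ Ctrap-above (s≤s (m≤n+m i g)) ⟩
    t C (suc g + i) ∸ t C (suc g + i ∸ suc i)
      ≡⟨ cong₂ _∸_ (sym ([m+n]Cm≡[m+n]Cn (suc g) (suc g + i))) (cong (t C_) (m+n∸n≡m g i)) ⟩
    t C suc g ∸ t C g
      ≡⟨ cong (λ m → m C suc g ∸ m C g) (t≡width i g) ⟩
    w C suc g ∸ w C g
      ≡⟨ cong (_∸ w C g) (sym (ballot-binomial (suc i) g)) ⟩
    ballot (suc i) (suc g) + w C g ∸ w C g
      ≡⟨ m+n∸n≡m (ballot (suc i) (suc g)) (w C g) ⟩
    ballot (suc i) (suc g)
      ∎
    where
    t = suc g + (suc g + i)
    w = width (suc i) g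
    t≡width : ∀ i g → suc g + (suc g + i) ≡ suc i + suc (g + g)
    t≡width = solve-∀

open Ballot using (ballot; Ctrap-ballot; [m+n]∸o∸m≡n∸o)

module Expansion {c ℓ : Level} (R : CommutativeRing c ℓ) where
  open CommutativeRing R hiding (zero)
  open import Algebra.Properties.CommutativeMonoid.Sum +-commutativeMonoid
    using (sum-syntax; ∑-distrib-+; sum-cong-≋; sum-replicate-zero)
  open import Algebra.Properties.Monoid.Mult +-monoid using (_×_; ×-homo-+)
  open import Data.Fin using (Fin; toℕ)
  open import Data.List using (foldr; applyUpTo)
  import Data.Nat.Properties as ℕ
  open import Relation.Binary.Reasoning.Setoid setoid

  Recurrence : (ℕ → ℕ → Carrier) → Set ℓ
  Recurrence x = ∀ n k → 1 ≤ n → 1 ≤ k → k ≤ n → x (n +ℕ 1) (k +ℕ 1) ≈ sumFromTo R (x n) k n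

  foldr-applyUpTo : ∀ f n → foldr _+_ 0# (applyUpTo f n) ≡.≡ ∑[ i < n ] f (toℕ i)
  foldr-applyUpTo f zero    = ≡.refl
  foldr-applyUpTo f (suc n) = ≡.cong (f 0 +_) (foldr-applyUpTo (λ i → f (suc i)) n)

  module _ (x : ℕ → ℕ → Carrier) (rec : Recurrence x) where

    recurrence-∑ : ∀ {n k} → 1 ≤ k → k ≤ n → x (suc n) (suc k) ≈ ∑[ i < suc n ∸ k ] x n (k +ℕ toℕ i)
    recurrence-∑ {n} {k} 1≤k k≤n = begin
      x (suc n) (suc k)                    ≡⟨ ≡.cong₂ x (ℕ.+-comm 1 n) (ℕ.+-comm 1 k) ⟩
      x (n +ℕ 1) (k +ℕ 1)                  ≈⟨ rec n k (ℕ.≤-trans 1≤k k≤n) 1≤k k≤n ⟩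
      sumFromTo R (x n) k n                ≡⟨ foldr-applyUpTo (λ i → x n (k +ℕ i)) (suc n ∸ k) ⟩
      ∑[ i < suc n ∸ k ] x n (k +ℕ toℕ i)  ∎

    column-step : ∀ {n k} → 1 ≤ k → k < n → x (suc n) (suc k) ≈ x n k + x (suc n) (suc (suc k))
    column-step {n} {k} 1≤k k<n = begin
      x (suc n) (suc k)
        ≈⟨ recurrence-∑ 1≤k (ℕ.<⇒≤ k<n) ⟩
      ∑[ i < suc n ∸ k ] x n (k +ℕ toℕ i)
        ≡⟨ ≡.cong (λ m → ∑[ i < m ] x n (k +ℕ toℕ i)) (ℕ.+-∸-assoc 1 (ℕ.<⇒≤ k<n)) ⟩
      x n (k +ℕ 0) + ∑[ i < n ∸ k ] x n (k +ℕ suc (toℕ i))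
        ≈⟨ +-cong (reflexive (≡.cong (x n) (ℕ.+-identityʳ k)))
                  (sum-cong-≋ {n ∸ k} λ i → reflexive (≡.cong (x n) (ℕ.+-suc k (toℕ i)))) ⟩
      x n k + ∑[ i < n ∸ k ] x n (suc k +ℕ toℕ i)
        ≈⟨ +-congˡ (sym (recurrence-∑ (s≤s z≤n) k<n)) ⟩
      x n k + x (suc n) (suc (suc k))
        ∎

    diagonal-step : ∀ {n} → 1 ≤ n → x (suc n) (suc n) ≈ x n n
    diagonal-step {n} 1≤n = begin
      x (suc n) (suc n)                    ≈⟨ recurrence-∑ 1≤n ℕ.≤-refl ⟩
      ∑[ i < suc n ∸ n ] x n (n +ℕ toℕ i)  ≡⟨ ≡.cong (λ m → ∑[ i < m ] x n (n +ℕ toℕ i)) (ℕ.m+n∸n≡m 1 n) ⟩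
      x n (n +ℕ 0) + 0#                    ≈⟨ +-identityʳ (x n (n +ℕ 0)) ⟩
      x n (n +ℕ 0)                         ≡⟨ ≡.cong (x n) (ℕ.+-identityʳ n) ⟩
      x n n                                ∎

    firstColumnExpansion : ℕ → ℕ → Carrier
    firstColumnExpansion j m = ∑[ h < m ] (ballot j (toℕ h) × x (m ∸ toℕ h) 1)

    diagonal : ∀ j → x (suc j) (suc j) ≈ x 1 1
    diagonal zero    = refl
    diagonal (suc j) = trans (diagonal-step (s≤s z≤n)) (diagonal j)

    column-expansion : ∀ d j → x (suc (j +ℕ d)) (suc j) ≈ firstColumnExpansion j (suc d)
    column-expansion zero j = begin
      x (suc (j +ℕ 0)) (suc j)       ≡⟨ ≡.cong (λ n → x (suc n) (suc j)) (ℕ.+-identityʳ j) ⟩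
      x (suc j) (suc j)              ≈⟨ diagonal j ⟩
      x 1 1                          ≈⟨ sym (trans (+-identityʳ _) (+-identityʳ _)) ⟩
      firstColumnExpansion j 1       ∎
    column-expansion (suc e) zero = sym (begin
      firstColumnExpansion 0 (suc (suc e))          ≈⟨ +-cong (+-identityʳ _) (sum-replicate-zero (suc e)) ⟩
      x (suc (suc e)) 1 + 0#                        ≈⟨ +-identityʳ _ ⟩
      x (suc (suc e)) 1                             ∎)
    column-expansion (suc e) (suc j) = begin
      x (suc (suc j +ℕ suc e)) (suc (suc j))
        ≈⟨ column-step (s≤s z≤n) (s≤s (ℕ.m<m+n j (s≤s z≤n))) ⟩
      x (suc (j +ℕ suc e)) (suc j) + x (suc (suc (j +ℕ suc e))) (suc (suc (suc j)))
        ≡⟨ ≡.cong (λ n → x (suc (j +ℕ suc e)) (suc j) + x (suc (suc n)) (suc (suc (suc j))))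
                  (ℕ.+-suc j e) ⟩
      x (suc (j +ℕ suc e)) (suc j) + x (suc (suc (suc j) +ℕ e)) (suc (suc (suc j)))
        ≈⟨ +-cong (column-expansion (suc e) j) (column-expansion e (suc (suc j))) ⟩
      ((x (suc (suc e)) 1 + 0#) + ∑[ h < suc e ] (a h × y h)) + ∑[ h < suc e ] (b h × y h)
        ≈⟨ +-assoc _ _ _ ⟩
      (x (suc (suc e)) 1 + 0#) + (∑[ h < suc e ] (a h × y h) + ∑[ h < suc e ] (b h × y h))
        ≈⟨ +-congˡ (sym (∑-distrib-+ (λ h → a h × y h) (λ h → b h × y h))) ⟩
      (x (suc (suc e)) 1 + 0#) + ∑[ h < suc e ] (a h × y h + b h × y h)
        ≈⟨ +-congˡ (sum-cong-≋ λ h → sym (×-homo-+ (y h) (a h) (b h))) ⟩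
      firstColumnExpansion (suc j) (suc (suc e))
        ∎
      where
      y : Fin (suc e) → Carrier
      y h = x (suc e ∸ toℕ h) 1
      a b : Fin (suc e) → ℕ
      a h = ballot j (suc (toℕ h))
      b h = ballot (suc (suc j)) (toℕ h)

    column-expansion-Ctrap : ∀ i d →
      x (suc (suc i +ℕ d)) (suc (suc i)) ≈
        sumFromTo R (λ h → Ctrap (suc i) h (h +ℕ i) × x (suc (suc i +ℕ d) ∸ h ∸ suc i) 1) 0 d
    column-expansion-Ctrap i d = begin
      x (suc (suc i +ℕ d)) (suc (suc i))    ≈⟨ column-expansion d (suc i) ⟩
      firstColumnExpansion (suc i) (suc d)  ≈⟨ sum-cong-≋ {suc d} (λ h → reflexive (coefficient (toℕ h))) ⟩
      ∑[ h < suc d ] term (toℕ h)           ≡⟨ ≡.sym (foldr-applyUpTo term (suc d)) ⟩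
      sumFromTo R term 0 d                  ∎
      where
      term : ℕ → Carrier
      term h = Ctrap (suc i) h (h +ℕ i) × x (suc (suc i +ℕ d) ∸ h ∸ suc i) 1
      row : ∀ h → suc (suc i +ℕ d) ∸ h ∸ suc i ≡.≡ suc d ∸ h
      row h = ≡.trans (≡.cong (λ n → n ∸ h ∸ suc i) (≡.sym (ℕ.+-suc (suc i) d)))
                      ([m+n]∸o∸m≡n∸o (suc i) (suc d) h)
      coefficient : ∀ h → ballot (suc i) h × x (suc d ∸ h) 1 ≡.≡ term h
      coefficient h = ≡.cong₂ (λ b n → b × x n 1) (≡.sym (Ctrap-ballot i h)) (≡.sym (row h))

open import Defs using (_×_)

corollary3p6 : {c ℓ : Level} (R : CommutativeRing c ℓ) →
    let open CommutativeRing R in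
    (x : ℕ → ℕ → Carrier) →
    (∀ n k → 1 ≤ n → 1 ≤ k → k ≤ n →
      x (n +ℕ 1) (k +ℕ 1) ≈ sumFromTo R (x n) k n) →
    ∀ n → 3 ≤ n →
      x n 3 ≈ sumFromTo R (λ h → _×_ R (Ctrap 2 h (h +ℕ 1)) (x (n ∸ h ∸ 2) 1)) 0 (n ∸ 3)
corollary3p6 R x rec (suc (suc (suc d))) (s≤s (s≤s (s≤s z≤n))) = Expansion.column-expansion-Ctrap R x rec 1 d
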